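{- Let $G$ be a finite group and let $\Gamma=\mathrm{Cay}(G,S)$ be a connected bipartite Cayley graph with $2n$ vertices and valency $k$ (so $|G|=2n$, $|S|=k$). Let $H$ be the part (colour class) of this bipartite graph which contains the identity element. If $n$ is odd or $k$ is odd, then $G$ is isomorphic to a semidirect product $H \rtimes \mathbb{Z}_2$.
   Context: For a finite group $G$ and an inverse-closed subset $S\subseteq G\setminus\{e\}$, the Cayley graph $\mathrm{Cay}(G,S)$ has vertex set $G$, with $a$ adjacent to $b$ if and only if $ab^{ -1}\in S$. A semidirect product $H\rtimes K$ is a group $G$ containing a normal subgroup $H_1\cong H$ and a subgroup $K_1\cong K$ with $G=H_1K_1$ and $H_1\cap K_1=\{e\}$; "$G$ is isomorphic to $H\rtimes\mathbb{Z}_2$" means $G$ admits such a decomposition with $H_1\cong H$ and $K_1$ of order $2$. -}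

module Defs where

open import Level using (Level; _⊔_)
open import Algebra.Bundles using (Group)
open import Data.Nat using (ℕ)
open import Data.Fin using (Fin)
open import Data.Bool using (Bool)
open import Data.Product using (Σ; _×_; ∃; _,_)
open import Data.Sum using (_⊎_)
open import Relation.Nullary using (¬_)
open import Relation.Binary.Bundles using (Setoid)
open import Relation.Binary.PropositionalEquality as ≡ using (_≡_; _≢_)
open import Function.Bundles using (Bijection)

module _ {c ℓ : Level} (G : Group c ℓ) where
  open Group G

  Respects≈ : (Carrier → Set) → Set (c ⊔ ℓ)
  Respects≈ P = ∀ {x y} → x ≈ y → P x → P y

  SubSetoid : (P : Carrier → Set) → Setoid c ℓ
  SubSetoid P = record
    { Carrier = Σ Carrier P
    ; _≈_ = λ a b → Σ.proj₁ a ≈ Σ.proj₁ b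
    ; isEquivalence = record
      { refl = refl ; sym = sym ; trans = trans } }
    where open Σ

  HasOrder : ℕ → Set (c ⊔ ℓ)
  HasOrder m = Bijection (≡.setoid (Fin m)) setoid

  HasCard : (Carrier → Set) → ℕ → Set (c ⊔ ℓ)
  HasCard P k = Bijection (≡.setoid (Fin k)) (SubSetoid P)

  IsCayleySubset : (Carrier → Set) → Set (c ⊔ ℓ)
  IsCayleySubset S = Respects≈ S × (∀ x → S x → S (x ⁻¹)) × ¬ S ε

  Adj : (Carrier → Set) → Carrier → Carrier → Set
  Adj S a b = S (a ∙ b ⁻¹)

  data Walk (S : Carrier → Set) : Carrier → Carrier → Set (c ⊔ ℓ) where
    here : ∀ {a b} → a ≈ b → Walk S a b
    step : ∀ {a b d} → Adj S a b → Walk S b d → Walk S a d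

  Connected : (Carrier → Set) → Set (c ⊔ ℓ)
  Connected S = ∀ a b → Walk S a b

  IsProper2Colouring : (Carrier → Set) → (Carrier → Bool) → Set (c ⊔ ℓ)
  IsProper2Colouring S col =
    (∀ {a b} → a ≈ b → col a ≡ col b) × (∀ {a b} → Adj S a b → col a ≢ col b)

  IdentityPart : (Carrier → Bool) → Carrier → Set
  IdentityPart col g = col g ≡ col ε

  -- G ≅ H ⋊ Z₂ (internal): H is a normal subgroup of G and there is a
  -- subgroup K = {e, t} of order 2 with G = HK and H ∩ K = {e}.
  IsSubgroup : (Carrier → Set) → Set c
  IsSubgroup H = H ε × (∀ x y → H x → H y → H (x ∙ y)) × (∀ x → H x → H (x ⁻¹))

  IsNormal : (Carrier → Set) → Set c
  IsNormal H = ∀ g h → H h → H (g ∙ h ∙ g ⁻¹)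

  IsSemidirectWithZ2 : (Carrier → Set) → Set (c ⊔ ℓ)
  IsSemidirectWithZ2 H =
    IsSubgroup H × IsNormal H ×
    Σ Carrier λ t →
      ¬ (t ≈ ε) × (t ∙ t ≈ ε) ×
      -- H ∩ K = {e}
      ¬ H t ×
      (∀ g → Σ Carrier λ h → H h × (g ≈ h ⊎ g ≈ h ∙ t))

module Submission where

-- Right translations are automorphisms of Cay(G,S), so whether two vertices have the same colour
-- is invariant under right translation; by connectivity, g ↦ col ε xor col g is therefore a
-- homomorphism G → ℤ₂ with kernel the identity part H. Every element of S lies outside H, so a
-- complement {ε, t} exists once some t ∉ H satisfies t = t⁻¹. Inversion is an involution of S and
-- of the coset G ∖ H, which has n elements because translation by a generator swaps the two
-- colour classes; an involution of a finite set of odd size has a fixed point.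

open import Defs
open import Level using (Level; _⊔_)
open import Algebra.Bundles using (Group)
import Algebra.Properties.Group as GroupProperties
open import Data.Nat using (ℕ; zero; suc; _+_; _*_)
open import Data.Nat.Properties using (+-0-commutativeMonoid; +-suc; *-suc; +-identityʳ; *-comm; *-cancelˡ-≡)
open import Algebra.Properties.CommutativeMonoid.Sum +-0-commutativeMonoid
  using (sum; sum-cong-≗; sum-permute)
open import Data.Nat.Divisibility using (_∣_; divides; _∣0)
open import Data.Bool using (Bool; true; false; not; _∧_; _xor_; if_then_else_)
open import Data.Bool.Properties
  using (xor-same; xor-identityʳ; xor-comm; xor-assoc; xor-inverseˡ; not-distribˡ-xor; ¬-not)
  renaming (_≟_ to _≟ᵇ_)
open import Data.Fin using (Fin; _<?_)
open import Data.Fin.Properties using (any?; <-cmp) renaming (_≟_ to _≟ᶠ_)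
open import Data.Fin.Permutation using (Permutation′; permutation; _⟨$⟩ʳ_)
open import Data.Product using (Σ; _×_; ∃; _,_; proj₁; proj₂)
open import Data.Sum using (_⊎_; inj₁; inj₂)
open import Function using (_∘_; const; case_of_)
open import Function.Bundles using (Bijection)
open import Function.Definitions using (Congruent; StrictlyInverseˡ; StrictlyInverseʳ)
open import Relation.Nullary using (¬_; yes; no; does; contradiction)
open import Relation.Nullary.Decidable using (_×-dec_; dec-true; dec-false)
open import Relation.Binary.Bundles using (Setoid)
open import Relation.Binary.Definitions using (tri<; tri≈; tri>)
open import Relation.Binary.PropositionalEquality as ≡ using (_≡_; _≢_; _≗_)

≡⇒xor≡false : ∀ {x y} → x ≡ y → x xor y ≡ false
≡⇒xor≡false {x} ≡.refl = xor-same x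

xor≡false⇒≡ : ∀ {x y} → x xor y ≡ false → x ≡ y
xor≡false⇒≡ {false} {false} _ = ≡.refl
xor≡false⇒≡ {true}  {true}  _ = ≡.refl

xor-cancel-middle : ∀ x y z → (x xor y) xor (y xor z) ≡ x xor z
xor-cancel-middle x y z = begin
  (x xor y) xor (y xor z) ≡⟨ xor-assoc x y (y xor z) ⟩
  x xor (y xor (y xor z)) ≡⟨ ≡.cong (x xor_) (≡.sym (xor-assoc y y z)) ⟩
  x xor ((y xor y) xor z) ≡⟨ ≡.cong (λ b → x xor (b xor z)) (xor-same y) ⟩
  x xor z                 ∎
  where open ≡.≡-Reasoning

+-self≡2* : ∀ n → n + n ≡ 2 * n
+-self≡2* n = ≡.cong (n +_) (≡.sym (+-identityʳ n))

module _ {m : ℕ} where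

  count : (Fin m → Bool) → ℕ
  count p = sum (λ i → if p i then 1 else 0)

  count-cong : ∀ {p q} → p ≗ q → count p ≡ count q
  count-cong p≗q = sum-cong-≗ (λ i → ≡.cong (λ b → if b then 1 else 0) (p≗q i))

  count-permute : ∀ p (π : Permutation′ m) → count (p ∘ (π ⟨$⟩ʳ_)) ≡ count p
  count-permute p π = ≡.sym (sum-permute (λ i → if p i then 1 else 0) π)

count-true : ∀ m → count {m} (const true) ≡ m
count-true zero    = ≡.refl
count-true (suc m) = ≡.cong suc (count-true m)

count-complement : ∀ {m} (p : Fin m → Bool) → count p + count (not ∘ p) ≡ m
count-complement {zero}  p = ≡.refl
count-complement {suc m} p with p Fin.zero | count-complement (p ∘ Fin.suc)
... | true  | ih = ≡.cong suc ih
... | false | ih = ≡.trans (+-suc _ _) (≡.cong suc ih)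

count-split : ∀ {m} (p q : Fin m → Bool) →
  count p ≡ count (λ i → p i ∧ q i) + count (λ i → p i ∧ not (q i))
count-split {zero}  p q = ≡.refl
count-split {suc m} p q with p Fin.zero | q Fin.zero | count-split (p ∘ Fin.suc) (q ∘ Fin.suc)
... | true  | true  | ih = ≡.cong suc ih
... | true  | false | ih = ≡.trans (≡.cong suc ih) (≡.sym (+-suc _ _))
... | false | _     | ih = ih

module _ {m : ℕ} (σ : Fin m → Fin m) (σ-involutive : ∀ i → σ (σ i) ≡ i) where

  private
    below : Fin m → Bool
    below i = does (i <? σ i)

    not-below : ∀ i → σ i ≢ i → not (below i) ≡ below (σ i)
    not-below i σi≢i with <-cmp i (σ i)
    ... | tri< i<σi _ σi≮i = ≡.trans (≡.cong not (dec-true (i <? σ i) i<σi))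
      (≡.sym (≡.trans (≡.cong (λ j → does (σ i <? j)) (σ-involutive i)) (dec-false (σ i <? i) σi≮i)))
    ... | tri≈ _ i≡σi _   = contradiction (≡.sym i≡σi) σi≢i
    ... | tri> i≮σi _ σi<i = ≡.trans (≡.cong not (dec-false (i <? σ i) i≮σi))
      (≡.sym (≡.trans (≡.cong (λ j → does (σ i <? j)) (σ-involutive i)) (dec-true (σ i <? i) σi<i)))

  -- σ maps {i ∈ p | i < σ i} bijectively onto {i ∈ p | ¬ i < σ i}, so count p is twice the former.
  fixedPointFree⇒2∣count : ∀ p → (∀ i → p (σ i) ≡ p i) →
    (∀ i → p i ≡ true → σ i ≢ i) → 2 ∣ count p
  fixedPointFree⇒2∣count p p∘σ≗p free =
    divides c (≡.trans (count-split p below)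
      (≡.trans (≡.cong (c +_) pairs) (≡.trans (+-self≡2* c) (*-comm 2 c))))
    where
    c : ℕ
    c = count (λ i → p i ∧ below i)
    σ-perm : Permutation′ m
    σ-perm = permutation σ σ σ-involutive σ-involutive
    pointwise : ∀ i → p i ∧ not (below i) ≡ p (σ i) ∧ below (σ i)
    pointwise i with p i in pi≡ | p∘σ≗p i
    ... | false | pσi≡ = ≡.cong (_∧ below (σ i)) (≡.sym pσi≡)
    ... | true  | pσi≡ = ≡.trans (not-below i (free i pi≡)) (≡.cong (_∧ below (σ i)) (≡.sym pσi≡))
    pairs : count (λ i → p i ∧ not (below i)) ≡ c
    pairs = ≡.trans (count-cong pointwise) (count-permute (λ i → p i ∧ below i) σ-perm)

  odd-count⇒fixedPoint : ∀ p → (∀ i → p (σ i) ≡ p i) → ¬ 2 ∣ count p →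
    ∃ λ i → p i ≡ true × σ i ≡ i
  odd-count⇒fixedPoint p p∘σ≗p odd with any? (λ i → (p i ≟ᵇ true) ×-dec (σ i ≟ᶠ i))
  ... | yes fixed = fixed
  ... | no  free  = contradiction
    (fixedPointFree⇒2∣count p p∘σ≗p (λ i pi σi≡i → free (i , pi , σi≡i))) odd

module FiniteSetoid {a ℓ : Level} {A : Setoid a ℓ} {m : ℕ}
  (enumeration : Bijection (≡.setoid (Fin m)) A) where

  open Setoid A
  open Bijection enumeration using (to; injective; strictlySurjective)

  index : Carrier → Fin m
  index x = proj₁ (strictlySurjective x)

  to-index : ∀ x → to (index x) ≈ x
  to-index x = proj₂ (strictlySurjective x)

  size : (Carrier → Bool) → ℕ
  size p = count (p ∘ to)

  private
    transport : (Carrier → Carrier) → Fin m → Fin m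
    transport f i = index (f (to i))

    transport-inverse : ∀ {f g} → Congruent _≈_ _≈_ f → StrictlyInverseˡ _≈_ f g →
      StrictlyInverseˡ _≡_ (transport f) (transport g)
    transport-inverse {f} {g} f-cong f∘g≈id i = injective (begin
      to (transport f (transport g i)) ≈⟨ to-index _ ⟩
      f (to (transport g i))           ≈⟨ f-cong (to-index _) ⟩
      f (g (to i))                     ≈⟨ f∘g≈id (to i) ⟩
      to i                             ∎)
      where open import Relation.Binary.Reasoning.Setoid A

  module _ {p : Carrier → Bool} (p-cong : ∀ {x y} → x ≈ y → p x ≡ p y) where

    size-∘-automorphism : ∀ {f g} → Congruent _≈_ _≈_ f → Congruent _≈_ _≈_ g →
      StrictlyInverseˡ _≈_ f g → StrictlyInverseʳ _≈_ f g → size (p ∘ f) ≡ size p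
    size-∘-automorphism {f} {g} f-cong g-cong f∘g≈id g∘f≈id = ≡.trans
      (count-cong (λ i → p-cong (sym (to-index (f (to i))))))
      (count-permute (p ∘ to) (permutation (transport f) (transport g)
        (transport-inverse f-cong f∘g≈id) (transport-inverse g-cong g∘f≈id)))

    odd-size⇒fixedPoint : ∀ {ι} → Congruent _≈_ _≈_ ι → StrictlyInverseˡ _≈_ ι ι →
      (∀ x → p (ι x) ≡ p x) → ¬ 2 ∣ size p → ∃ λ x → p x ≡ true × ι x ≈ x
    odd-size⇒fixedPoint {ι} ι-cong ι-involutive p∘ι≗p odd
      with odd-count⇒fixedPoint (transport ι) (transport-inverse ι-cong ι-involutive) (p ∘ to)
             (λ i → ≡.trans (p-cong (to-index _)) (p∘ι≗p (to i))) odd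
    ... | i , pi , fixed = to i , pi , trans (sym (to-index _)) (reflexive (≡.cong to fixed))

module Z₂Character {c ℓ : Level} (G : Group c ℓ) (χ : Group.Carrier G → Bool)
  (χ-cong : ∀ {x y} → Group._≈_ G x y → χ x ≡ χ y)
  (χ-homo : ∀ x y → χ (Group._∙_ G x y) ≡ χ x xor χ y) where

  open Group G

  χ-ε : χ ε ≡ false
  χ-ε = ≡.trans (χ-cong (sym (identityˡ ε))) (≡.trans (χ-homo ε ε) (xor-same (χ ε)))

  χ-⁻¹ : ∀ x → χ (x ⁻¹) ≡ χ x
  χ-⁻¹ x = ≡.sym (xor≡false⇒≡
    (≡.trans (≡.sym (χ-homo x (x ⁻¹))) (≡.trans (χ-cong (inverseʳ x)) χ-ε)))

  module _ (H : Carrier → Set)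
    (H⇒χ≡false : ∀ {g} → H g → χ g ≡ false) (χ≡false⇒H : ∀ {g} → χ g ≡ false → H g) where

    kernel-isSemidirectWithZ2 : ∀ t → χ t ≡ true → t ∙ t ≈ ε → IsSemidirectWithZ2 G H
    kernel-isSemidirectWithZ2 t χt t∙t≈ε =
      (χ≡false⇒H χ-ε , ∙-closed , ⁻¹-closed) , normal , t , t≉ε , t∙t≈ε , t∉H , cosets
      where
      ∙-closed : ∀ x y → H x → H y → H (x ∙ y)
      ∙-closed x y hx hy = χ≡false⇒H
        (≡.trans (χ-homo x y) (≡.cong₂ _xor_ (H⇒χ≡false hx) (H⇒χ≡false hy)))

      ⁻¹-closed : ∀ x → H x → H (x ⁻¹)
      ⁻¹-closed x hx = χ≡false⇒H (≡.trans (χ-⁻¹ x) (H⇒χ≡false hx))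

      normal : ∀ g h → H h → H (g ∙ h ∙ g ⁻¹)
      normal g h hh = χ≡false⇒H (begin
        χ (g ∙ h ∙ g ⁻¹)        ≡⟨ χ-homo (g ∙ h) (g ⁻¹) ⟩
        χ (g ∙ h) xor χ (g ⁻¹)  ≡⟨ ≡.cong₂ _xor_ (χ-homo g h) (χ-⁻¹ g) ⟩
        (χ g xor χ h) xor χ g   ≡⟨ ≡.cong (λ b → (χ g xor b) xor χ g) (H⇒χ≡false hh) ⟩
        (χ g xor false) xor χ g ≡⟨ ≡.cong (_xor χ g) (xor-identityʳ (χ g)) ⟩
        χ g xor χ g             ≡⟨ xor-same (χ g) ⟩
        false                   ∎)
        where open ≡.≡-Reasoning

      t∉H : ¬ H t
      t∉H ht with ≡.trans (≡.sym χt) (H⇒χ≡false ht)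
      ... | ()

      t≉ε : ¬ t ≈ ε
      t≉ε t≈ε = t∉H (χ≡false⇒H (≡.trans (χ-cong t≈ε) χ-ε))

      cosets : ∀ g → Σ Carrier λ h → H h × (g ≈ h ⊎ g ≈ h ∙ t)
      cosets g with χ g in χg
      ... | false = g , χ≡false⇒H χg , inj₁ refl
      ... | true  = g ∙ t , χ≡false⇒H (≡.trans (χ-homo g t) (≡.cong₂ _xor_ χg χt)) , inj₂ (begin
        g             ≈⟨ identityʳ g ⟨
        g ∙ ε         ≈⟨ ∙-congˡ t∙t≈ε ⟨
        g ∙ (t ∙ t)   ≈⟨ assoc g t t ⟨
        (g ∙ t) ∙ t   ∎)
        where open import Relation.Binary.Reasoning.Setoid setoid

module BipartiteCayley {c ℓ : Level} (G : Group c ℓ) (S : Group.Carrier G → Set)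
  (S-resp : Respects≈ G S) (connected : Connected G S) (col : Group.Carrier G → Bool)
  (col-cong : ∀ {a b} → Group._≈_ G a b → col a ≡ col b)
  (proper : ∀ {a b} → Adj G S a b → col a ≢ col b) where

  open Group G
  open GroupProperties G using (ε⁻¹≈ε; ⁻¹-anti-homo-∙; //-rightDividesˡ; //-rightDividesʳ; ⁻¹-involutive)

  Adj-∙ʳ : ∀ {a b} d → Adj G S a b → Adj G S (a ∙ d) (b ∙ d)
  Adj-∙ʳ {a} {b} d = S-resp (begin
    a ∙ b ⁻¹                 ≈⟨ ∙-congʳ (//-rightDividesʳ d a) ⟨
    a ∙ d ∙ d ⁻¹ ∙ b ⁻¹      ≈⟨ assoc (a ∙ d) (d ⁻¹) (b ⁻¹) ⟩
    a ∙ d ∙ (d ⁻¹ ∙ b ⁻¹)    ≈⟨ ∙-congˡ (⁻¹-anti-homo-∙ b d) ⟨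
    a ∙ d ∙ (b ∙ d) ⁻¹       ∎)
    where open import Relation.Binary.Reasoning.Setoid setoid

  colourChange-∙ʳ : ∀ {a b} → Walk G S a b → ∀ d → col a xor col b ≡ col (a ∙ d) xor col (b ∙ d)
  colourChange-∙ʳ (here a≈b) d = ≡.trans (≡⇒xor≡false (col-cong a≈b))
    (≡.sym (≡⇒xor≡false (col-cong (∙-congʳ a≈b))))
  colourChange-∙ʳ {a} {e} (step {b = b} a~b walk) d = begin
    col a xor col e                     ≡⟨ ≡.cong (_xor col e) (¬-not (proper a~b)) ⟩
    not (col b) xor col e               ≡⟨ not-distribˡ-xor (col b) (col e) ⟨
    not (col b xor col e)               ≡⟨ ≡.cong not (colourChange-∙ʳ walk d) ⟩
    not (col (b ∙ d) xor col (e ∙ d))   ≡⟨ not-distribˡ-xor (col (b ∙ d)) (col (e ∙ d)) ⟩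
    not (col (b ∙ d)) xor col (e ∙ d)   ≡⟨ ≡.cong (_xor col (e ∙ d)) (¬-not (proper (Adj-∙ʳ d a~b))) ⟨
    col (a ∙ d) xor col (e ∙ d)         ∎
    where open ≡.≡-Reasoning

  parity : Carrier → Bool
  parity g = col ε xor col g

  parity-cong : ∀ {x y} → x ≈ y → parity x ≡ parity y
  parity-cong x≈y = ≡.cong (col ε xor_) (col-cong x≈y)

  parity-homo : ∀ x y → parity (x ∙ y) ≡ parity x xor parity y
  parity-homo x y = begin
    parity (x ∙ y)                              ≡⟨ xor-cancel-middle (col ε) (col y) (col (x ∙ y)) ⟨
    parity y xor (col y xor col (x ∙ y))        ≡⟨ ≡.cong (λ b → parity y xor (b xor col (x ∙ y))) (col-cong (identityˡ y)) ⟨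
    parity y xor (col (ε ∙ y) xor col (x ∙ y))  ≡⟨ ≡.cong (parity y xor_) (colourChange-∙ʳ (connected ε x) y) ⟨
    parity y xor parity x                       ≡⟨ xor-comm (parity y) (parity x) ⟩
    parity x xor parity y                       ∎
    where open ≡.≡-Reasoning

  parity-generator : ∀ {s} → S s → parity s ≡ true
  parity-generator {s} s∈S = ≡.trans
    (≡.cong (_xor col s) (¬-not (λ eq → proper s~ε (≡.sym eq))))
    (xor-inverseˡ (col s))
    where
    s~ε : Adj G S s ε
    s~ε = S-resp (sym (trans (∙-congˡ ε⁻¹≈ε) (identityʳ s))) s∈S

  open Z₂Character G parity parity-cong parity-homo

  isSemidirectWithZ2 : ∀ t → parity t ≡ true → t ∙ t ≈ ε → IsSemidirectWithZ2 G (IdentityPart G col)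
  isSemidirectWithZ2 = kernel-isSemidirectWithZ2 (IdentityPart G col)
    (λ g∈H → ≡⇒xor≡false (≡.sym g∈H)) (λ parity≡false → ≡.sym (xor≡false⇒≡ parity≡false))

  OddInvolution : Set (c ⊔ ℓ)
  OddInvolution = Σ Carrier λ t → parity t ≡ true × t ∙ t ≈ ε

  selfInverse⇒square≈ε : ∀ {t} → t ⁻¹ ≈ t → t ∙ t ≈ ε
  selfInverse⇒square≈ε {t} t⁻¹≈t = trans (∙-congˡ (sym t⁻¹≈t)) (inverseʳ t)

  odd-valency⇒oddInvolution : ∀ {k} → (∀ x → S x → S (x ⁻¹)) → HasCard G S k → ¬ 2 ∣ k →
    OddInvolution
  odd-valency⇒oddInvolution {k} S-inv enumeration k-odd =
    let ((s , s∈S) , _ , s⁻¹≈s) = odd-size⇒fixedPoint (λ _ → ≡.refl) {ι} ⁻¹-cong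
          (λ x → ⁻¹-involutive (proj₁ x)) (λ _ → ≡.refl)
          (≡.subst (λ size → ¬ 2 ∣ size) (≡.sym (count-true k)) k-odd)
    in s , parity-generator s∈S , selfInverse⇒square≈ε s⁻¹≈s
    where
    open FiniteSetoid enumeration
    ι : Σ Carrier S → Σ Carrier S
    ι (x , x∈S) = x ⁻¹ , S-inv x x∈S

  walk⇒generator : ∀ {a b} → ¬ a ≈ b → Walk G S a b → Σ Carrier S
  walk⇒generator a≉b (here a≈b)                   = contradiction a≈b a≉b
  walk⇒generator _   (step {a = a} {b = b} a~b _) = a ∙ b ⁻¹ , a~b

  generator : ∀ {m} → HasOrder G (2 + m) → Σ Carrier S
  generator enumeration = walk⇒generator {to Fin.zero} {to (Fin.suc Fin.zero)}
    (λ eq → case injective eq of λ ()) (connected _ _)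
    where open Bijection enumeration using (to; injective)

  parity-balanced : ∀ {n} (enumeration : HasOrder G (2 * n)) → Σ Carrier S →
    FiniteSetoid.size enumeration parity ≡ n
  parity-balanced {n} enumeration (s , s∈S) = *-cancelˡ-≡ (size parity) n 2 (begin
    2 * size parity                    ≡⟨ +-self≡2* (size parity) ⟨
    size parity + size parity          ≡⟨ ≡.cong (size parity +_) translation ⟨
    size parity + size (not ∘ parity)  ≡⟨ count-complement (parity ∘ to) ⟩
    2 * n                              ∎)
    where
    open ≡.≡-Reasoning
    open FiniteSetoid enumeration
    open Bijection enumeration using (to)
    flip-parity : ∀ x → not (parity x) ≡ parity (x ∙ s)
    flip-parity x = ≡.sym (≡.trans (parity-homo x s)
      (≡.trans (≡.cong (parity x xor_) (parity-generator s∈S)) (xor-comm (parity x) true)))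
    translation : size (not ∘ parity) ≡ size parity
    translation = ≡.trans (count-cong (flip-parity ∘ to))
      (size-∘-automorphism parity-cong ∙-congʳ ∙-congʳ (//-rightDividesˡ s) (//-rightDividesʳ s))

  odd-halfOrder⇒oddInvolution : ∀ {n} → HasOrder G (2 * n) → ¬ 2 ∣ n → OddInvolution
  odd-halfOrder⇒oddInvolution {zero}  _           n-odd = contradiction (2 ∣0) n-odd
  odd-halfOrder⇒oddInvolution {suc n} enumeration n-odd =
    let (t , t-odd , t⁻¹≈t) = odd-size⇒fixedPoint parity-cong ⁻¹-cong ⁻¹-involutive χ-⁻¹
          (≡.subst (λ size → ¬ 2 ∣ size) (≡.sym (parity-balanced enumeration s)) n-odd)
    in t , t-odd , selfInverse⇒square≈ε t⁻¹≈t
    where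
    open FiniteSetoid enumeration
    s : Σ Carrier S
    s = generator (≡.subst (HasOrder G) (*-suc 2 n) enumeration)

lemma3p2 : {c ℓ : Level} (G : Group c ℓ) (S : Group.Carrier G → Set) (n k : ℕ) →
    IsCayleySubset G S → HasOrder G (2 * n) → HasCard G S k →
    Connected G S → (col : Group.Carrier G → Bool) → IsProper2Colouring G S col →
    (¬ (2 ∣ n) ⊎ ¬ (2 ∣ k)) →
    IsSemidirectWithZ2 G (IdentityPart G col)
lemma3p2 G S n k (S-resp , S-inv , _) order valency connected col (col-cong , proper) odd =
  let (t , t-odd , t∙t≈ε) = oddInvolution odd in isSemidirectWithZ2 t t-odd t∙t≈ε
  where
  open BipartiteCayley G S S-resp connected col col-cong proper
  oddInvolution : ¬ 2 ∣ n ⊎ ¬ 2 ∣ k → OddInvolution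
  oddInvolution (inj₁ n-odd) = odd-halfOrder⇒oddInvolution order n-odd
  oddInvolution (inj₂ k-odd) = odd-valency⇒oddInvolution S-inv valency k-odd
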